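{- For every integer $n\geq 4$, the circular ladder $CL_n$ satisfies $\chi_g(CL_n)=5$ if $n\equiv 0 \pmod 4$, and $\chi_g(CL_n)=6$ otherwise.
   Context: All graphs are finite, simple and connected. A graceful $k$-coloring of a non-empty graph $G$ ($k\geq 2$) is a proper vertex coloring $f:V(G)\to\{1,2,\dots,k\}$ such that the induced edge coloring $f^*(uv)=|f(u)-f(v)|$, with values in $\{1,\dots,k-1\}$, is a proper edge coloring. The graceful chromatic number $\chi_g(G)$ is the minimum such $k$. The circular ladder $CL_n$ has vertex set $\{x_i,y_i:1\leq i\leq n\}$ and edge set $\{x_ix_{i+1},y_iy_{i+1}:1\leq i\leq n-1\}\cup\{x_iy_i:1\leq i\leq n\}\cup\{x_1x_n,y_1y_n\}$ (i.e. $CL_n=C_n\Box P_2$). -}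

module Defs where

open import Data.Nat using (ℕ; zero; suc; _+_; _≤_; _<_; _%_; NonZero)
open import Data.Nat.Properties using ()
open import Data.Fin using (Fin; toℕ)
open import Data.Bool using (Bool)
open import Data.Product using (_×_; Σ; _,_; proj₁; proj₂)
open import Data.Sum using (_⊎_)
open import Relation.Nullary using (¬_)
open import Relation.Binary.PropositionalEquality using (_≡_; _≢_)

dist : ℕ → ℕ → ℕ
dist zero    n       = n
dist (suc m) zero    = suc m
dist (suc m) (suc n) = dist m n

record Graph : Set₁ where
  field
    V   : Set
    Adj : V → V → Set

open Graph public

-- A graceful k-colouring: f : V → {1,…,k}; colours are encoded as Fin k
-- (colour c ∈ {1..k} is represented by toℕ c = c - 1; differences are unchanged).
-- (i) f is a proper vertex colouring;
-- (ii) the induced edge colouring uv ↦ |f u - f v| is proper: two distinct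
--      edges u v and u w sharing the endpoint u (v ≢ w) get different colours.
record GracefulColoring (G : Graph) (k : ℕ) : Set where
  field
    k≥2    : 2 ≤ k
    col    : V G → Fin k
    proper : ∀ u v → Adj G u v → col u ≢ col v
    edgeProper : ∀ u v w → Adj G u v → Adj G u w → v ≢ w →
                 dist (toℕ (col u)) (toℕ (col v)) ≢ dist (toℕ (col u)) (toℕ (col w))

GracefulChromaticNumber : Graph → ℕ → Set
GracefulChromaticNumber G k =
  GracefulColoring G k × (∀ j → j < k → ¬ GracefulColoring G j)

-- Circular ladder CL_n = C_n □ P_2. Vertex (i , false) is x_{i+1}, (i , true) is y_{i+1}.
-- Cycle adjacency on Fin n: j = i + 1 (mod n) or i = j + 1 (mod n).
CycAdj : (n : ℕ) → .{{NonZero n}} → Fin n → Fin n → Set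
CycAdj n i j = (toℕ j ≡ (toℕ i + 1) % n) ⊎ (toℕ i ≡ (toℕ j + 1) % n)

CL : (n : ℕ) → .{{NonZero n}} → Graph
CL n = record
  { V   = Fin n × Bool
  ; Adj = λ p q → ((proj₂ p ≡ proj₂ q) × CycAdj n (proj₁ p) (proj₁ q))
                ⊎ ((proj₁ p ≡ proj₁ q) × (proj₂ p ≢ proj₂ q))
  }

-- Read CL_n rung by rung: a colouring is a cyclic sequence of rungs R_i = (colour of x_i, colour
-- of y_i).  Every vertex has degree 3, so for n ≥ 3 the colouring is graceful exactly when, for any
-- three consecutive rungs, both vertices of the middle rung see three distinct nonzero edge labels.
-- This local condition is decidable, and exhaustive search shows that with 4 colours no four
-- consecutive rungs satisfy it, while with 5 colours any five consecutive rungs satisfy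
-- R_{i+3} = swap R_{i+1}.  A rung is never its own swap, so R_1, R_3, R_5, … returns to R_1 only
-- after an even number of steps; it returns after n steps and, when n = 2h, after h steps, so 4 ∣ n.
-- Conversely, powers of the closed word (0,1)(3,4)(1,0)(4,3) give 5-colourings when 4 ∣ n, and
-- powers of (0,2)(1,3)(4,0)(3,5) followed by one of three short closed words give 6-colourings.

module Submission where

open import Data.Bool using (Bool; true; false; not)
open import Data.Bool.Properties using (not-¬; ¬-not)
open import Data.Empty using (⊥-elim)
open import Data.Fin using (Fin; toℕ; inject≤; #_)
open import Data.Fin.Properties
  using (toℕ-injective; toℕ-fromℕ<; toℕ<n; toℕ-inject≤; inject≤-injective; all?)
  renaming (_≟_ to _≟ᶠ_)
open import Data.List using (List; []; _∷_; _++_; length)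
open import Data.List.Properties using (length-++; ++-assoc)
open import Data.Nat
  using (ℕ; zero; suc; pred; _+_; _*_; _≤_; _<_; _%_; _/_; _≟_; NonZero; z≤n; s≤s; s≤s⁻¹)
open import Data.Nat.Properties
open import Data.Nat.DivMod
open import Data.Nat.Tactic.RingSolver using (solve-∀)
open import Data.Nat.Divisibility
  using (_∣_; divides; _∣0; ∣-refl; ∣m∣n⇒∣m+n; *-monoˡ-∣; n∣m⇒m%n≡0)
open import Data.Product using (_×_; _,_; proj₁; proj₂; swap; ∃)
open import Data.Product.Properties using (≡-dec; swap-involutive)
open import Data.Sum using (inj₁; inj₂)
open import Relation.Binary.PropositionalEquality
open import Relation.Nullary using (¬_; Dec; yes; no; ¬?; _×-dec_; _→-dec_)
open import Relation.Nullary.Decidable using (map′; toWitness)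
open import Function using (_∘_)
open import Defs

≡⇒dist≡0 : ∀ {m n} → m ≡ n → dist m n ≡ 0
≡⇒dist≡0 {zero}  refl = refl
≡⇒dist≡0 {suc m} refl = ≡⇒dist≡0 {m} refl

dist≡0⇒≡ : ∀ m n → dist m n ≡ 0 → m ≡ n
dist≡0⇒≡ zero    zero    _  = refl
dist≡0⇒≡ (suc m) (suc n) eq = cong suc (dist≡0⇒≡ m n eq)

record GracefulStar (c x y z : ℕ) : Set where
  field
    ℓx≢0  : dist c x ≢ 0
    ℓy≢0  : dist c y ≢ 0
    ℓz≢0  : dist c z ≢ 0
    ℓx≢ℓy : dist c x ≢ dist c y
    ℓx≢ℓz : dist c x ≢ dist c z
    ℓy≢ℓz : dist c y ≢ dist c z

gracefulStar? : ∀ c x y z → Dec (GracefulStar c x y z)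
gracefulStar? c x y z = map′
  (λ (p , q , r , s , t , u) → record
     { ℓx≢0 = p ; ℓy≢0 = q ; ℓz≢0 = r ; ℓx≢ℓy = s ; ℓx≢ℓz = t ; ℓy≢ℓz = u })
  (λ σ → let open GracefulStar σ in ℓx≢0 , ℓy≢0 , ℓz≢0 , ℓx≢ℓy , ℓx≢ℓz , ℓy≢ℓz)
  (¬? (dist c x ≟ 0) ×-dec ¬? (dist c y ≟ 0) ×-dec ¬? (dist c z ≟ 0) ×-dec
   ¬? (dist c x ≟ dist c y) ×-dec ¬? (dist c x ≟ dist c z) ×-dec ¬? (dist c y ≟ dist c z))

graceful-star : ∀ {G k} (g : GracefulColoring G k) → let open GracefulColoring g in
  ∀ {u v w x} → Adj G u v → Adj G u w → Adj G u x → v ≢ w → v ≢ x → w ≢ x →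
  GracefulStar (toℕ (col u)) (toℕ (col v)) (toℕ (col w)) (toℕ (col x))
graceful-star g {u} {v} {w} {x} uv uw ux v≢w v≢x w≢x = record
  { ℓx≢0  = proper u v uv ∘ color-eq
  ; ℓy≢0  = proper u w uw ∘ color-eq
  ; ℓz≢0  = proper u x ux ∘ color-eq
  ; ℓx≢ℓy = edgeProper u v w uv uw v≢w
  ; ℓx≢ℓz = edgeProper u v x uv ux v≢x
  ; ℓy≢ℓz = edgeProper u w x uw ux w≢x
  }
  where
  open GracefulColoring g
  color-eq : ∀ {a b} → dist (toℕ (col a)) (toℕ (col b)) ≡ 0 → col a ≡ col b
  color-eq d = toℕ-injective (dist≡0⇒≡ _ _ d)

coloring-mono : ∀ {G j k} → j ≤ k → GracefulColoring G j → GracefulColoring G k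
coloring-mono j≤k g = record
  { k≥2        = ≤-trans k≥2 j≤k
  ; col        = λ u → inject≤ (col u) j≤k
  ; proper     = λ u v uv eq → proper u v uv (inject≤-injective j≤k j≤k _ _ eq)
  ; edgeProper = λ u v w uv uw v≢w eq → edgeProper u v w uv uw v≢w
      (trans (sym (dist-inject≤ u v)) (trans eq (dist-inject≤ u w)))
  }
  where
  open GracefulColoring g
  dist-inject≤ : ∀ u v → dist (toℕ (inject≤ (col u) j≤k)) (toℕ (inject≤ (col v) j≤k))
                       ≡ dist (toℕ (col u)) (toℕ (col v))
  dist-inject≤ u v = cong₂ dist (toℕ-inject≤ (col u) j≤k) (toℕ-inject≤ (col v) j≤k)

Rung : ℕ → Set
Rung k = Fin k × Fin k

color : ∀ {k} → Bool → Rung k → Fin k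
color false = proj₁
color true  = proj₂

-- The star of the row-b vertex on rung B: its cycle neighbours lie on rungs A and C.
RowStar : ∀ {k} → Bool → Rung k → Rung k → Rung k → Set
RowStar b A B C =
  GracefulStar (toℕ (color b B)) (toℕ (color b A)) (toℕ (color b C)) (toℕ (color (not b) B))

ValidTriple : ∀ {k} → Rung k → Rung k → Rung k → Set
ValidTriple A B C = ∀ b → RowStar b A B C

validTriple? : ∀ {k} (A B C : Rung k) → Dec (ValidTriple A B C)
validTriple? A B C = map′ (λ { (x , y) false → x ; (x , y) true → y }) (λ v → v false , v true)
  (gracefulStar? _ _ _ _ ×-dec gracefulStar? _ _ _ _)

rung-proper : ∀ {k} {A B C : Rung k} → ValidTriple A B C → proj₁ B ≢ proj₂ B
rung-proper v eq = GracefulStar.ℓz≢0 (v false) (≡⇒dist≡0 (cong toℕ eq))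

ValidTriple-cong : ∀ {k} {A A′ B B′ C C′ : Rung k} → A ≡ A′ → B ≡ B′ → C ≡ C′ →
  ValidTriple A B C → ValidTriple A′ B′ C′
ValidTriple-cong refl refl refl v = v

∀-rung? : ∀ {k} {P : Rung k → Set} → (∀ A → Dec (P A)) → Dec (∀ A → P A)
∀-rung? P? = map′ (λ h (a , b) → h a b) (λ h a b → h (a , b)) (all? λ a → all? λ b → P? (a , b))

-- Both facts are decided by exhaustive search; interleaving quantifiers and hypotheses prunes the
-- search at every invalid triple.
no-valid-window₄ : (A B C : Rung 4) → ValidTriple A B C → (D : Rung 4) → ¬ ValidTriple B C D
no-valid-window₄ = toWitness {a? = ∀-rung? λ A → ∀-rung? λ B → ∀-rung? λ C →
  validTriple? A B C →-dec ∀-rung? λ D → ¬? (validTriple? B C D)} _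

valid-window₅-swaps : (A B C : Rung 5) → ValidTriple A B C → (D : Rung 5) → ValidTriple B C D →
                      (E : Rung 5) → ValidTriple C D E → D ≡ swap B
valid-window₅-swaps = toWitness {a? = ∀-rung? λ A → ∀-rung? λ B → ∀-rung? λ C →
  validTriple? A B C →-dec ∀-rung? λ D → validTriple? B C D →-dec ∀-rung? λ E →
  validTriple? C D E →-dec ≡-dec _≟ᶠ_ _≟ᶠ_ D (swap B)} _

module _ {n : ℕ} .{{_ : NonZero n}} where

  toℕ-mod : ∀ m → toℕ (m mod n) ≡ m % n
  toℕ-mod m = toℕ-fromℕ< (m%n<n m n)

  mod-cong : ∀ {a b} → a % n ≡ b % n → a mod n ≡ b mod n
  mod-cong eq = toℕ-injective (trans (toℕ-mod _) (trans eq (sym (toℕ-mod _))))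

  toℕ-mod-inverse : ∀ i → toℕ i mod n ≡ i
  toℕ-mod-inverse i = toℕ-injective (trans (toℕ-mod _) (m<n⇒m%n≡m (toℕ<n i)))

  %-congˡ-+ : ∀ c {a b} → a % n ≡ b % n → (c + a) % n ≡ (c + b) % n
  %-congˡ-+ c {a} {b} eq = begin
    (c + a) % n          ≡⟨ %-distribˡ-+ c a n ⟩
    (c % n + a % n) % n  ≡⟨ cong (λ r → (c % n + r) % n) eq ⟩
    (c % n + b % n) % n  ≡⟨ %-distribˡ-+ c b n ⟨
    (c + b) % n          ∎
    where open ≡-Reasoning

  %-cancelˡ-+ : ∀ c {a b} → (c + a) % n ≡ (c + b) % n → a % n ≡ b % n
  %-cancelˡ-+ zero    eq = eq
  %-cancelˡ-+ (suc c) eq = %-cancelˡ-+ c (%-cancel-suc eq)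
    where
    pred-shift : ∀ a → (pred n + suc a) % n ≡ a % n
    pred-shift a = begin
      (pred n + suc a) % n  ≡⟨ cong (_% n) (+-suc (pred n) a) ⟩
      (suc (pred n) + a) % n ≡⟨ cong (λ m → (m + a) % n) (suc-pred n) ⟩
      (n + a) % n           ≡⟨ cong (_% n) (+-comm n a) ⟩
      (a + n) % n           ≡⟨ [m+n]%n≡m%n a n ⟩
      a % n                 ∎
      where open ≡-Reasoning
    %-cancel-suc : ∀ {a b} → suc a % n ≡ suc b % n → a % n ≡ b % n
    %-cancel-suc {a} {b} eq = trans (sym (pred-shift a)) (trans (%-congˡ-+ (pred n) eq) (pred-shift b))

  toℕ-mod-suc : ∀ m → (toℕ (m mod n) + 1) % n ≡ suc m % n
  toℕ-mod-suc m = trans (cong (_% n) (+-comm _ 1))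
                        (%-congˡ-+ 1 (trans (cong (_% n) (toℕ-mod m)) (m%n%n≡m%n m n)))

  mod-surjective-suc : ∀ i → ∃ λ m → suc m mod n ≡ i
  mod-surjective-suc i = toℕ i + pred n , trans (mod-cong wraps) (toℕ-mod-inverse i)
    where
    wraps : suc (toℕ i + pred n) % n ≡ toℕ i % n
    wraps = trans (cong (_% n) (trans (sym (+-suc (toℕ i) (pred n))) (cong (toℕ i +_) (suc-pred n))))
                  ([m+n]%n≡m%n (toℕ i) n)

  mod-two-apart : 3 ≤ n → ∀ m → m mod n ≢ suc (suc m) mod n
  mod-two-apart n≥3 m eq = 0≢1+n (begin
    0      ≡⟨ m<n⇒m%n≡m (≤-trans (s≤s z≤n) n≥3) ⟨
    0 % n  ≡⟨ %-cancelˡ-+ m same-remainder ⟩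
    2 % n  ≡⟨ m<n⇒m%n≡m n≥3 ⟩
    2      ∎)
    where
    open ≡-Reasoning
    same-remainder : (m + 0) % n ≡ (m + 2) % n
    same-remainder = begin
      (m + 0) % n              ≡⟨ cong (_% n) (+-identityʳ m) ⟩
      m % n                    ≡⟨ toℕ-mod m ⟨
      toℕ (m mod n)            ≡⟨ cong toℕ eq ⟩
      toℕ (suc (suc m) mod n)  ≡⟨ toℕ-mod (2 + m) ⟩
      (2 + m) % n              ≡⟨ cong (_% n) (+-comm 2 m) ⟩
      (m + 2) % n              ∎

  next-unique : ∀ {m j} → toℕ j ≡ (toℕ (m mod n) + 1) % n → j ≡ suc m mod n
  next-unique {m} e = toℕ-injective (trans e (trans (toℕ-mod-suc m) (sym (toℕ-mod (suc m)))))

  prev-unique : ∀ {m j} → toℕ (suc m mod n) ≡ (toℕ j + 1) % n → j ≡ m mod n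
  prev-unique {m} {j} e = toℕ-injective (begin
    toℕ j          ≡⟨ m<n⇒m%n≡m (toℕ<n j) ⟨
    toℕ j % n      ≡⟨ %-cancelˡ-+ 1 same-successor ⟩
    m % n          ≡⟨ toℕ-mod m ⟨
    toℕ (m mod n)  ∎)
    where
    open ≡-Reasoning
    same-successor : (1 + toℕ j) % n ≡ (1 + m) % n
    same-successor = trans (cong (_% n) (+-comm 1 (toℕ j))) (trans (sym e) (toℕ-mod (suc m)))

  data Neighbour (m : ℕ) (b : Bool) : Fin n × Bool → Set where
    left   : Neighbour m b (m mod n , b)
    right  : Neighbour m b (suc (suc m) mod n , b)
    across : Neighbour m b (suc m mod n , not b)

  neighbour : ∀ {m b v} → Adj (CL n) (suc m mod n , b) v → Neighbour m b v
  neighbour {v = j , _} (inj₁ (refl , inj₁ e)) with refl ← next-unique e = right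
  neighbour {v = j , _} (inj₁ (refl , inj₂ e)) with refl ← prev-unique e = left
  neighbour {v = _ , b′} (inj₂ (refl , b≢b′)) with refl ← ¬-not (b≢b′ ∘ sym) = across

  neighbour-adjacent : ∀ {m b v} → Neighbour m b v → Adj (CL n) (suc m mod n , b) v
  neighbour-adjacent {m} left   = inj₁ (refl , inj₂ (trans (toℕ-mod (suc m)) (sym (toℕ-mod-suc m))))
  neighbour-adjacent {m} right  = inj₁ (refl , inj₁ (trans (toℕ-mod (2 + m)) (sym (toℕ-mod-suc (suc m)))))
  neighbour-adjacent     across = inj₂ (refl , not-¬ refl)

  rungs : ∀ {k} → GracefulColoring (CL n) k → Fin n → Rung k
  rungs g i = col (i , false) , col (i , true)
    where open GracefulColoring g

  ValidRungs : ∀ {k} → (Fin n → Rung k) → Set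
  ValidRungs R = ∀ m → ValidTriple (R (m mod n)) (R (suc m mod n)) (R (suc (suc m) mod n))

  graceful-star-at : ∀ {k} → 3 ≤ n → (g : GracefulColoring (CL n) k) → let open GracefulColoring g in
    ∀ m b → GracefulStar (toℕ (col (suc m mod n , b))) (toℕ (col (m mod n , b)))
                         (toℕ (col (suc (suc m) mod n , b))) (toℕ (col (suc m mod n , not b)))
  graceful-star-at n≥3 g m b =
    graceful-star g (neighbour-adjacent left) (neighbour-adjacent right) (neighbour-adjacent across)
      (mod-two-apart n≥3 m ∘ cong proj₁) (not-¬ refl ∘ cong proj₂) (not-¬ refl ∘ cong proj₂)

  rungs-valid : ∀ {k} → 3 ≤ n → (g : GracefulColoring (CL n) k) → ValidRungs (rungs g)
  rungs-valid n≥3 g m false = graceful-star-at n≥3 g m false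
  rungs-valid n≥3 g m true  = graceful-star-at n≥3 g m true

  coloring-of-rungs : ∀ {k} → 2 ≤ k → (R : Fin n → Rung k) → ValidRungs R →
                      GracefulColoring (CL n) k
  coloring-of-rungs {k} k≥2 R valid = record
    { k≥2 = k≥2 ; col = col ; proper = proper ; edgeProper = edgeProper }
    where
    col : Fin n × Bool → Fin k
    col (i , b) = color b (R i)

    label : ℕ → Bool → Fin n × Bool → ℕ
    label m b v = dist (toℕ (col (suc m mod n , b))) (toℕ (col v))

    label≢0 : ∀ {m b v} → Neighbour m b v → label m b v ≢ 0
    label≢0 {m} {b} left   = GracefulStar.ℓx≢0 (valid m b)
    label≢0 {m} {b} right  = GracefulStar.ℓy≢0 (valid m b)
    label≢0 {m} {b} across = GracefulStar.ℓz≢0 (valid m b)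

    labels-distinct : ∀ {m b v w} → Neighbour m b v → Neighbour m b w → v ≢ w →
                      label m b v ≢ label m b w
    labels-distinct         left   left   v≢w = ⊥-elim (v≢w refl)
    labels-distinct {m} {b} left   right  _   = GracefulStar.ℓx≢ℓy (valid m b)
    labels-distinct {m} {b} left   across _   = GracefulStar.ℓx≢ℓz (valid m b)
    labels-distinct {m} {b} right  left   _   = GracefulStar.ℓx≢ℓy (valid m b) ∘ sym
    labels-distinct         right  right  v≢w = ⊥-elim (v≢w refl)
    labels-distinct {m} {b} right  across _   = GracefulStar.ℓy≢ℓz (valid m b)
    labels-distinct {m} {b} across left   _   = GracefulStar.ℓx≢ℓz (valid m b) ∘ sym
    labels-distinct {m} {b} across right  _   = GracefulStar.ℓy≢ℓz (valid m b) ∘ sym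
    labels-distinct         across across v≢w = ⊥-elim (v≢w refl)

    proper : ∀ u v → Adj (CL n) u v → col u ≢ col v
    proper (i , b) v uv eq with m , refl ← mod-surjective-suc i =
      label≢0 (neighbour uv) (≡⇒dist≡0 (cong toℕ eq))

    edgeProper : ∀ u v w → Adj (CL n) u v → Adj (CL n) u w → v ≢ w →
                 dist (toℕ (col u)) (toℕ (col v)) ≢ dist (toℕ (col u)) (toℕ (col w))
    edgeProper (i , b) v w uv uw v≢w with m , refl ← mod-surjective-suc i =
      labels-distinct (neighbour uv) (neighbour uw) v≢w

no-4-coloring : ∀ {n} .{{_ : NonZero n}} → 3 ≤ n → ¬ GracefulColoring (CL n) 4
no-4-coloring n≥3 g = no-valid-window₄ _ _ _ (valid 0) _ (valid 1)
  where
  valid : ValidRungs (rungs g)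
  valid = rungs-valid n≥3 g

no-coloring-below-5 : ∀ {n} .{{_ : NonZero n}} → 3 ≤ n →
                      ∀ j → j < 5 → ¬ GracefulColoring (CL n) j
no-coloring-below-5 n≥3 j j<5 = no-4-coloring n≥3 ∘ coloring-mono (s≤s⁻¹ j<5)

involution-orbit-even : ∀ {A : Set} (f : A → A) → (∀ x → f (f x) ≡ x) → (F : ℕ → A) →
  (∀ t → F (suc t) ≡ f (F t)) → f (F 0) ≢ F 0 → ∀ t → F t ≡ F 0 → 2 ∣ t
involution-orbit-even f involutive F step moved = even
  where
  two-steps : ∀ t → F (suc (suc t)) ≡ F t
  two-steps t = trans (step (suc t)) (trans (cong f (step t)) (involutive (F t)))

  even : ∀ t → F t ≡ F 0 → 2 ∣ t
  even zero          _  = 2 ∣0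
  even (suc zero)    eq = ⊥-elim (moved (trans (sym (step 0)) eq))
  even (suc (suc t)) eq = ∣m∣n⇒∣m+n ∣-refl (even t (trans (sym (two-steps t)) eq))

five-coloring⇒4∣n : ∀ {n} .{{_ : NonZero n}} → 3 ≤ n → GracefulColoring (CL n) 5 → 4 ∣ n
five-coloring⇒4∣n {n} n≥3 g = four-divides (orbit-even n (returns n 2 (*-comm n 2)))
  where
  valid : ValidRungs (rungs g)
  valid = rungs-valid n≥3 g

  -- F t is the rung at position 2t+1; it returns to F 0 after n steps, and after h steps if n = 2h.
  F : ℕ → Rung 5
  F t = rungs g (suc (t * 2) mod n)

  step : ∀ t → F (suc t) ≡ swap (F t)
  step t = valid-window₅-swaps _ _ _ (valid (t * 2)) _ (valid (suc (t * 2))) _ (valid (suc (suc (t * 2))))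

  orbit-even : ∀ t → F t ≡ F 0 → 2 ∣ t
  orbit-even = involution-orbit-even swap swap-involutive F step (rung-proper (valid 0) ∘ cong proj₂)

  returns : ∀ t q → t * 2 ≡ q * n → F t ≡ F 0
  returns t q eq = cong (rungs g) (mod-cong (trans (cong (λ x → suc x % n) eq) ([m+kn]%n≡m%n 1 q n)))

  four-divides : 2 ∣ n → 4 ∣ n
  four-divides (divides h n≡h*2) = subst (4 ∣_) (sym n≡h*2)
    (*-monoˡ-∣ 2 (orbit-even h (returns h 1 (trans (sym n≡h*2) (sym (*-identityˡ n))))))

no-coloring-below-6 : ∀ {n} .{{_ : NonZero n}} → 3 ≤ n → n % 4 ≢ 0 →
                      ∀ j → j < 6 → ¬ GracefulColoring (CL n) j
no-coloring-below-6 {n} n≥3 n%4≢0 j j<6 g with m≤n⇒m<n∨m≡n (s≤s⁻¹ j<6)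
... | inj₁ j<5  = no-coloring-below-5 n≥3 j j<5 g
... | inj₂ refl = n%4≢0 (n∣m⇒m%n≡0 n 4 (five-coloring⇒4∣n n≥3 g))

data ValidWalk {k} : List (Rung k) → Set where
  end : ∀ {A B} → ValidWalk (A ∷ B ∷ [])
  _∷_ : ∀ {A B C w} → ValidTriple A B C → ValidWalk (B ∷ C ∷ w) → ValidWalk (A ∷ B ∷ C ∷ w)

validWalk? : ∀ {k} (w : List (Rung k)) → Dec (ValidWalk w)
validWalk? []              = no λ ()
validWalk? (_ ∷ [])        = no λ ()
validWalk? (_ ∷ _ ∷ [])    = yes end
validWalk? (A ∷ B ∷ C ∷ w) = map′ (λ (t , v) → t ∷ v) (λ { (t ∷ v) → t , v })
  (validTriple? A B C ×-dec validWalk? (B ∷ C ∷ w))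

walk-++ : ∀ {k} (xs : List (Rung k)) {A B ys} →
  ValidWalk (xs ++ A ∷ B ∷ []) → ValidWalk (A ∷ B ∷ ys) → ValidWalk (xs ++ A ∷ B ∷ ys)
walk-++ []               _               v = v
walk-++ (_ ∷ [])         (t ∷ end)       v = t ∷ v
walk-++ (_ ∷ _ ∷ [])     (t ∷ t′ ∷ end)  v = t ∷ t′ ∷ v
walk-++ (_ ∷ y ∷ z ∷ zs) (t ∷ u)         v = t ∷ walk-++ (y ∷ z ∷ zs) u v

lookupOr : ∀ {A : Set} → A → List A → ℕ → A
lookupOr d []       _       = d
lookupOr d (x ∷ xs) zero    = x
lookupOr d (x ∷ xs) (suc i) = lookupOr d xs i

lookupOr-++ˡ : ∀ {A : Set} (d : A) xs {ys i} → i < length xs →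
  lookupOr d (xs ++ ys) i ≡ lookupOr d xs i
lookupOr-++ˡ d (x ∷ xs) {i = zero}  _         = refl
lookupOr-++ˡ d (x ∷ xs) {i = suc i} (s≤s i<n) = lookupOr-++ˡ d xs i<n

lookupOr-++ʳ : ∀ {A : Set} (d : A) xs {ys} i → lookupOr d (xs ++ ys) (length xs + i) ≡ lookupOr d ys i
lookupOr-++ʳ d []       i = refl
lookupOr-++ʳ d (x ∷ xs) i = lookupOr-++ʳ d xs i

walk-lookupOr : ∀ {k} (d : Rung k) {w} → ValidWalk w → ∀ i → 2 + i < length w →
  ValidTriple (lookupOr d w i) (lookupOr d w (1 + i)) (lookupOr d w (2 + i))
walk-lookupOr d (t ∷ _) zero    _        = t
walk-lookupOr d (_ ∷ v) (suc i) (s≤s lt) = walk-lookupOr d v i lt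
walk-lookupOr d end     _       (s≤s (s≤s ()))

-- The cyclic word A B u; repeating A B at the end covers the two triples that wrap around.
record ClosedWalk {k} (A B : Rung k) (u : List (Rung k)) : Set where
  constructor closed
  field walk : ValidWalk (A ∷ B ∷ u ++ A ∷ B ∷ [])

closed-++ : ∀ {k} {A B : Rung k} {u v} →
  ClosedWalk A B u → ClosedWalk A B v → ClosedWalk A B (u ++ A ∷ B ∷ v)
closed-++ {A = A} {B} {u} {v} (closed cu) (closed cv) = closed
  (subst (λ w → ValidWalk (A ∷ B ∷ w)) (sym (++-assoc u (A ∷ B ∷ v) (A ∷ B ∷ [])))
    (walk-++ (A ∷ B ∷ u) cu cv))

-- A ∷ B ∷ blocks A B u q v is the cyclic word (A B u)^q A B v.
blocks : ∀ {k} → Rung k → Rung k → List (Rung k) → ℕ → List (Rung k) → List (Rung k)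
blocks A B u zero    v = v
blocks A B u (suc q) v = u ++ A ∷ B ∷ blocks A B u q v

closed-blocks : ∀ {k} {A B : Rung k} {u v} → ClosedWalk A B u → ClosedWalk A B v →
  ∀ q → ClosedWalk A B (blocks A B u q v)
closed-blocks cu cv zero    = cv
closed-blocks cu cv (suc q) = closed-++ cu (closed-blocks cu cv q)

length-blocks : ∀ {k} {A B : Rung k} u v q → length (blocks A B u q v) ≡ length v + q * (2 + length u)
length-blocks u v zero    = sym (+-identityʳ (length v))
length-blocks {A = A} {B} u v (suc q) = begin
  length (u ++ A ∷ B ∷ blocks A B u q v)           ≡⟨ length-++ u ⟩
  length u + (2 + length (blocks A B u q v))       ≡⟨ cong (λ l → length u + (2 + l)) (length-blocks u v q) ⟩
  length u + (2 + (length v + q * (2 + length u))) ≡⟨ regroup (length u) (length v) (q * (2 + length u)) ⟩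
  length v + suc q * (2 + length u)                ∎
  where
  open ≡-Reasoning
  regroup : ∀ a b c → a + (2 + (b + c)) ≡ b + ((2 + a) + c)
  regroup = solve-∀

lookupOr-closed : ∀ {k} {A B : Rung k} u {n} .{{_ : NonZero n}} → 2 + length u ≡ n →
  ∀ i → i < n + 2 → lookupOr A (A ∷ B ∷ u ++ A ∷ B ∷ []) i ≡ lookupOr A (A ∷ B ∷ u) (i % n)
lookupOr-closed {A = A} {B} u {n} len i i<n+2 with i <? n
... | yes i<n = trans (lookupOr-++ˡ A (A ∷ B ∷ u) (subst (i <_) (sym len) i<n))
                      (cong (lookupOr A (A ∷ B ∷ u)) (sym (m<n⇒m%n≡m i<n)))
... | no i≮n with r , refl ← m≤n⇒∃[o]m+o≡n (≮⇒≥ i≮n) = begin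
  lookupOr A (A ∷ B ∷ u ++ A ∷ B ∷ []) (n + r)
    ≡⟨ cong (λ l → lookupOr A (A ∷ B ∷ u ++ A ∷ B ∷ []) (l + r)) (sym len) ⟩
  lookupOr A (A ∷ B ∷ u ++ A ∷ B ∷ []) (length (A ∷ B ∷ u) + r) ≡⟨ lookupOr-++ʳ A (A ∷ B ∷ u) r ⟩
  lookupOr A (A ∷ B ∷ []) r                                     ≡⟨ wrap r r<2 ⟩
  lookupOr A (A ∷ B ∷ u) r                                      ≡⟨ cong (lookupOr A (A ∷ B ∷ u)) r≡[n+r]%n ⟩
  lookupOr A (A ∷ B ∷ u) ((n + r) % n)                          ∎
  where
  open ≡-Reasoning
  r<2 : r < 2
  r<2 = +-cancelˡ-< n r 2 i<n+2
  r≡[n+r]%n : r ≡ (n + r) % n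
  r≡[n+r]%n = begin
    r            ≡⟨ m<n⇒m%n≡m (≤-trans r<2 (subst (2 ≤_) len (m≤m+n 2 (length u)))) ⟨
    r % n        ≡⟨ [m+n]%n≡m%n r n ⟨
    (r + n) % n  ≡⟨ cong (_% n) (+-comm r n) ⟩
    (n + r) % n  ∎
  wrap : ∀ r → r < 2 → lookupOr A (A ∷ B ∷ []) r ≡ lookupOr A (A ∷ B ∷ u) r
  wrap 0 _ = refl
  wrap 1 _ = refl
  wrap (suc (suc _)) (s≤s (s≤s ()))

coloring-of-closed-walk : ∀ {k n} .{{_ : NonZero n}} {A B : Rung k} {u} → 2 ≤ k → 2 + length u ≡ n →
  ClosedWalk A B u → GracefulColoring (CL n) k
coloring-of-closed-walk {k} {n} {A} {B} {u} k≥2 len (closed walk) = coloring-of-rungs k≥2 R valid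
  where
  R : Fin n → Rung k
  R i = lookupOr A (A ∷ B ∷ u) (toℕ i)

  bound : ∀ m t → t ≤ 2 → t + m % n < n + 2
  bound m t t≤2 = subst (t + m % n <_) (+-comm 2 n) (+-mono-≤-< t≤2 (m%n<n m n))

  from-walk : ∀ m t → t ≤ 2 →
              lookupOr A (A ∷ B ∷ u ++ A ∷ B ∷ []) (t + m % n) ≡ R ((t + m) mod n)
  from-walk m t t≤2 = begin
    lookupOr A (A ∷ B ∷ u ++ A ∷ B ∷ []) (t + m % n)
      ≡⟨ lookupOr-closed u len (t + m % n) (bound m t t≤2) ⟩
    lookupOr A (A ∷ B ∷ u) ((t + m % n) % n)
      ≡⟨ cong (lookupOr A (A ∷ B ∷ u)) (%-congˡ-+ t (m%n%n≡m%n m n)) ⟩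
    lookupOr A (A ∷ B ∷ u) ((t + m) % n)
      ≡⟨ cong (lookupOr A (A ∷ B ∷ u)) (toℕ-mod (t + m)) ⟨
    R ((t + m) mod n)
      ∎
    where open ≡-Reasoning

  valid : ValidRungs R
  valid m = ValidTriple-cong (from-walk m 0 z≤n) (from-walk m 1 (s≤s z≤n)) (from-walk m 2 ≤-refl)
    (walk-lookupOr A walk (m % n)
      (subst (2 + m % n <_) (sym (trans (length-++ (A ∷ B ∷ u)) (cong (_+ 2) len))) (bound m 2 ≤-refl)))

block₅ : ClosedWalk {5} (# 0 , # 1) (# 3 , # 4) ((# 1 , # 0) ∷ (# 4 , # 3) ∷ [])
block₅ = closed (toWitness {a? = validWalk? _} _)

block₆ : ClosedWalk {6} (# 0 , # 2) (# 1 , # 3) ((# 4 , # 0) ∷ (# 3 , # 5) ∷ [])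
block₆ = closed (toWitness {a? = validWalk? _} _)

tail₁ : ClosedWalk {6} (# 0 , # 2) (# 1 , # 3) ((# 5 , # 0) ∷ (# 2 , # 4) ∷ (# 3 , # 5) ∷ [])
tail₁ = closed (toWitness {a? = validWalk? _} _)

tail₂ : ClosedWalk {6} (# 0 , # 2) (# 1 , # 3)
  ((# 4 , # 0) ∷ (# 5 , # 1) ∷ (# 2 , # 4) ∷ (# 3 , # 5) ∷ [])
tail₂ = closed (toWitness {a? = validWalk? _} _)

tail₃ : ClosedWalk {6} (# 0 , # 2) (# 1 , # 3)
  ((# 4 , # 0) ∷ (# 3 , # 5) ∷ (# 0 , # 2) ∷ (# 4 , # 1) ∷ (# 3 , # 5) ∷ [])
tail₃ = closed (toWitness {a? = validWalk? _} _)

five-coloring : ∀ {n} .{{_ : NonZero n}} q → n ≡ suc q * 4 → GracefulColoring (CL n) 5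
five-coloring q n≡ = coloring-of-closed-walk (s≤s (s≤s z≤n))
  (trans (cong (2 +_) (length-blocks _ _ q)) (sym n≡)) (closed-blocks block₅ block₅ q)

six-coloring-with-tail : ∀ {n} .{{_ : NonZero n}} q {v} → ClosedWalk {6} (# 0 , # 2) (# 1 , # 3) v →
                         n ≡ 2 + (length v + q * 4) → GracefulColoring (CL n) 6
six-coloring-with-tail q tail n≡ = coloring-of-closed-walk (s≤s (s≤s z≤n))
  (trans (cong (2 +_) (length-blocks _ _ q)) (sym n≡)) (closed-blocks block₆ tail q)

six-coloring : ∀ {n} .{{_ : NonZero n}} q r → r ≢ 0 → r < 4 → n ≡ r + suc q * 4 →
               GracefulColoring (CL n) 6
six-coloring q 0 r≢0 _ _  = ⊥-elim (r≢0 refl)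
six-coloring q 1 _   _ n≡ = six-coloring-with-tail q tail₁ n≡
six-coloring q 2 _   _ n≡ = six-coloring-with-tail q tail₂ n≡
six-coloring q 3 _   _ n≡ = six-coloring-with-tail q tail₃ n≡
six-coloring q (suc (suc (suc (suc _)))) _ (s≤s (s≤s (s≤s (s≤s ())))) _

m≡m%4+[1+q]*4 : ∀ m → 4 ≤ m → ∃ λ q → m ≡ m % 4 + suc q * 4
m≡m%4+[1+q]*4 m m≥4 with m / 4 | m≡m%n+[m/n]*n m 4 | m≥n⇒m/n>0 {m} {4} m≥4
... | suc q | m≡ | _ = q , m≡

theorem3p9 : (n : ℕ) → .{{_ : NonZero n}} → 4 ≤ n →
    ((n % 4 ≡ 0) → GracefulChromaticNumber (CL n) 5)
    × ((n % 4 ≢ 0) → GracefulChromaticNumber (CL n) 6)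
theorem3p9 n n≥4 with q , n≡ ← m≡m%4+[1+q]*4 n n≥4 =
    (λ n%4≡0 → five-coloring q (trans n≡ (cong (_+ suc q * 4) n%4≡0)) , no-coloring-below-5 n≥3)
  , (λ n%4≢0 → six-coloring q (n % 4) n%4≢0 (m%n<n n 4) n≡ , no-coloring-below-6 n≥3 n%4≢0)
  where
  n≥3 : 3 ≤ n
  n≥3 = ≤-trans (n≤1+n 3) n≥4
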